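{- Let $(a_n)_{n\ge1}$ be a sequence of positive integers, $n\ge1$, and let $x_n,x_0\in\mathbb Z$ satisfy $2^{b_n}x_n-3^nx_0=B_n$. Define $x_1=\frac{3x_0+1}{2^{a_1}},\dots,x_{n-1}=\frac{3x_{n-2}+1}{2^{a_{n-1}}}$. Then $x_n=\frac{3x_{n-1}+1}{2^{a_n}}$ and $x_i\in\mathbb Z$ for all $0\le i\le n$.
   Context: $b_0=0$, $b_n=\sum_{i=1}^n a_i$, and $B_n=\sum_{i=0}^{n-1}3^{n-1-i}2^{b_i}$. -}

module Defs where

open import Data.Nat as ℕ using (ℕ; zero; suc; _∸_)
open import Data.Nat.Properties using (m^n≢0)
open import Data.List using (map; upTo)
open import Data.Nat.ListAction using (sum)
open import Data.Integer as ℤ using (ℤ)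
open import Data.Rational as ℚ using (ℚ; _/_)

-- b_0 = 0, b_n = a_1 + ... + a_n   (the sequence a is indexed from 1; a 0 is unused)
b : (ℕ → ℕ) → ℕ → ℕ
b a zero    = 0
b a (suc n) = b a n ℕ.+ a (suc n)

B : (ℕ → ℕ) → ℕ → ℕ
B a n = sum (map (λ i → 3 ℕ.^ (n ∸ 1 ∸ i) ℕ.* 2 ℕ.^ b a i) (upTo n))

ι : ℤ → ℚ
ι z = z / 1

step : ℚ → ℕ → ℚ
step y k = (ι (ℤ.+ 3) ℚ.* y ℚ.+ ι (ℤ.+ 1)) ℚ.* (ℤ.+ 1 / (2 ℕ.^ k))
  where instance _ = m^n≢0 2 k

xs : (ℕ → ℕ) → ℤ → ℕ → ℚ
xs a x0 zero    = ι x0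
xs a x0 (suc i) = step (xs a x0 i) (a (suc i))

-- Call y a solution of the m-th identity when 2^{b_m} y = 3^m x_0 + B_m.  By the
-- recurrence B_{m+1} = 3 B_m + 2^{b_m}, a solution y at index m+1 satisfies
--   2^{b_m} (2^{a_{m+1}} y - 1) = 3 (3^m x_0 + B_m);
-- as 2^{b_m} is coprime to 3 it divides 3^m x_0 + B_m, and the quotient y' solves
-- the m-th identity with 2^{a_{m+1}} y = 3 y' + 1.  Hence solutions descend to all
-- smaller indices, and since one rational step sends y' to the integer y exactly
-- when 2^k y = 3 y' + 1, every solution at index m is the m-th iterate.
module Submission where

open import Defs
open import Data.Nat as ℕ using (ℕ; zero; suc; _≤_; _<_; _∸_)
import Data.Nat.Properties as ℕP
import Data.Nat.Divisibility as ℕD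
open import Data.Nat.Coprimality using (Coprime)
open import Data.Nat.Primality using (Prime; prime?; euclidsLemma; prime⇒irreducible; ¬prime[1])
open import Data.Nat.ListAction using (sum)
open import Data.Nat.ListAction.Properties using (sum-++)
open import Data.Integer as ℤ using (ℤ; +_; ∣_∣)
import Data.Integer.Properties as ℤP
import Data.Integer.Coprimality as ℤC
import Data.Integer.Divisibility.Signed as ℤS
open import Data.Integer.Tactic.RingSolver using (solve-∀)
open import Data.Rational as ℚ using (_/_)
import Data.Rational.Properties as ℚP
import Data.Rational.Unnormalised as ℚᵘ
import Data.Rational.Unnormalised.Properties as ℚᵘP
open import Data.List using (List; []; _∷_; map; upTo; _++_; [_])
open import Data.List.Properties using (map-++; upTo-∷ʳ)
open import Data.List.Relation.Unary.All using (All; []; _∷_)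
open import Data.List.Relation.Unary.All.Properties using (applyUpTo⁺₁)
open import Data.Product using (_×_; _,_; ∃-syntax; proj₁; proj₂)
open import Data.Sum using (inj₁; inj₂)
open import Data.Empty using (⊥-elim)
open import Function using (id; _∘_)
open import Relation.Nullary using (¬_)
open import Relation.Nullary.Decidable using (toWitness)
open import Relation.Binary.PropositionalEquality using (_≡_; refl; sym; trans; cong; cong₂; subst; module ≡-Reasoning)

sum-upTo-suc : ∀ (f : ℕ → ℕ) m →
  sum (map f (upTo (suc m))) ≡ sum (map f (upTo m)) ℕ.+ f m
sum-upTo-suc f m = begin
  sum (map f (upTo (suc m)))            ≡⟨ cong (sum ∘ map f) (upTo-∷ʳ m) ⟨
  sum (map f (upTo m ++ [ m ]))         ≡⟨ cong sum (map-++ f (upTo m) [ m ]) ⟩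
  sum (map f (upTo m) ++ [ f m ])       ≡⟨ sum-++ (map f (upTo m)) [ f m ] ⟩
  sum (map f (upTo m)) ℕ.+ (f m ℕ.+ 0)  ≡⟨ cong (sum (map f (upTo m)) ℕ.+_) (ℕP.+-identityʳ (f m)) ⟩
  sum (map f (upTo m)) ℕ.+ f m          ∎
  where open ≡-Reasoning

sum-map-scale : ∀ c (f g : ℕ → ℕ) (is : List ℕ) → All (λ i → f i ≡ c ℕ.* g i) is →
  sum (map f is) ≡ c ℕ.* sum (map g is)
sum-map-scale c f g []       []       = sym (ℕP.*-zeroʳ c)
sum-map-scale c f g (i ∷ is) (p ∷ ps) = begin
  f i ℕ.+ sum (map f is)              ≡⟨ cong₂ ℕ._+_ p (sum-map-scale c f g is ps) ⟩
  c ℕ.* g i ℕ.+ c ℕ.* sum (map g is)  ≡⟨ ℕP.*-distribˡ-+ c (g i) _ ⟨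
  c ℕ.* (g i ℕ.+ sum (map g is))      ∎
  where open ≡-Reasoning

∸-pred : ∀ {i m} → i < m → m ∸ i ≡ suc (m ∸ 1 ∸ i)
∸-pred {i} {m} i<m = trans (ℕP.+-∸-assoc 1 i<m) (cong suc (sym (ℕP.∸-+-assoc m 1 i)))

-- Every term of B_{m+1} but the last is three times the corresponding term
-- of B_m; the last term is 2^{b_m}.
B-suc : ∀ a m → B a (suc m) ≡ 3 ℕ.* B a m ℕ.+ 2 ℕ.^ b a m
B-suc a m = begin
  B a (suc m)                        ≡⟨ sum-upTo-suc term m ⟩
  sum (map term (upTo m)) ℕ.+ term m ≡⟨ cong₂ ℕ._+_ scaled last ⟩
  3 ℕ.* B a m ℕ.+ 2 ℕ.^ b a m        ∎
  where
  open ≡-Reasoning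
  term : ℕ → ℕ
  term i = 3 ℕ.^ (m ∸ i) ℕ.* 2 ℕ.^ b a i
  termᵐ : ℕ → ℕ
  termᵐ i = 3 ℕ.^ (m ∸ 1 ∸ i) ℕ.* 2 ℕ.^ b a i
  shift : ∀ {i} → i < m → term i ≡ 3 ℕ.* termᵐ i
  shift {i} i<m rewrite ∸-pred i<m = ℕP.*-assoc 3 (3 ℕ.^ (m ∸ 1 ∸ i)) (2 ℕ.^ b a i)
  scaled : sum (map term (upTo m)) ≡ 3 ℕ.* B a m
  scaled = sum-map-scale 3 term termᵐ (upTo m) (applyUpTo⁺₁ id m shift)
  last : term m ≡ 2 ℕ.^ b a m
  last = trans (cong (λ e → 3 ℕ.^ e ℕ.* 2 ℕ.^ b a m) (ℕP.n∸n≡0 m)) (ℕP.*-identityˡ _)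

prime∣^⇒∣ : ∀ {p m} k → Prime p → p ℕD.∣ m ℕ.^ k → p ℕD.∣ m
prime∣^⇒∣ zero pp p∣1 = ⊥-elim (¬prime[1] (subst Prime (ℕD.∣1⇒≡1 p∣1) pp))
prime∣^⇒∣ {m = m} (suc k) pp p∣mᵏ⁺¹ with euclidsLemma m (m ℕ.^ k) pp p∣mᵏ⁺¹
... | inj₁ p∣m  = p∣m
... | inj₂ p∣mᵏ = prime∣^⇒∣ k pp p∣mᵏ

^-coprime-prime : ∀ {p m} k → Prime p → ¬ p ℕD.∣ m → Coprime (m ℕ.^ k) p
^-coprime-prime k pp p∤m (d∣mᵏ , d∣p) with prime⇒irreducible pp d∣p
... | inj₁ d≡1  = d≡1
... | inj₂ refl = ⊥-elim (p∤m (prime∣^⇒∣ k pp d∣mᵏ))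

2^-coprime-3 : ∀ k → Coprime (2 ℕ.^ k) 3
2^-coprime-3 k = ^-coprime-prime k (toWitness {a? = prime? 3} _) 3∤2
  where
  3∤2 : ¬ 3 ℕD.∣ 2
  3∤2 3∣2 with ℕD.∣⇒≤ 3∣2
  ... | ℕ.s≤s (ℕ.s≤s ())

coprime-3-split : ∀ P w R .{{_ : ℤ.NonZero P}} → Coprime ∣ P ∣ 3 →
  P ℤ.* w ≡ + 3 ℤ.* R → ∃[ y ] (R ≡ P ℤ.* y) × (w ≡ + 3 ℤ.* y)
coprime-3-split P w R coprime Pw≡3R = y , R≡Py , w≡3y
  where
  P∣3R : ℤS._∣_ P (+ 3 ℤ.* R)
  P∣3R = ℤS.divides w (trans (sym Pw≡3R) (ℤP.*-comm P w))
  P∣R : ℤS._∣_ P R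
  P∣R = ℤS.∣ᵤ⇒∣ (ℤC.coprime-divisor P (+ 3) R coprime (ℤS.∣⇒∣ᵤ P∣3R))
  y : ℤ
  y = ℤS._∣_.quotient P∣R
  R≡Py : R ≡ P ℤ.* y
  R≡Py = trans (ℤS._∣_.equality P∣R) (ℤP.*-comm y P)
  w≡3y : w ≡ + 3 ℤ.* y
  w≡3y = ℤP.*-cancelˡ-≡ P w (+ 3 ℤ.* y) (begin
    P ℤ.* w            ≡⟨ Pw≡3R ⟩
    + 3 ℤ.* R          ≡⟨ cong (+ 3 ℤ.*_) R≡Py ⟩
    + 3 ℤ.* (P ℤ.* y)  ≡⟨ swap (+ 3) P y ⟩
    P ℤ.* (+ 3 ℤ.* y)  ∎)
    where
    open ≡-Reasoning
    swap : ∀ u v t → u ℤ.* (v ℤ.* t) ≡ v ℤ.* (u ℤ.* t)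
    swap = solve-∀

toℚᵘ-/ : ∀ i n .{{_ : ℕ.NonZero n}} → ℚ.toℚᵘ (i / n) ℚᵘ.≃ (i ℚᵘ./ n)
toℚᵘ-/ i (suc d) = ℚP.toℚᵘ-fromℚᵘ (ℚᵘ.mkℚᵘ i d)

toℚᵘ-affine : ∀ N .{{_ : ℕ.NonZero N}} y →
  ℚ.toℚᵘ ((ι (+ 3) ℚ.* ι y ℚ.+ ι (+ 1)) ℚ.* (+ 1 / N)) ℚᵘ.≃ ((+ 3 ℤ.* y ℤ.+ + 1) ℚᵘ./ N)
toℚᵘ-affine (suc d) y = begin
  ℚ.toℚᵘ ((ι (+ 3) ℚ.* ι y ℚ.+ ι (+ 1)) ℚ.* (+ 1 / suc d))
    ≈⟨ ℚP.toℚᵘ-homo-* (ι (+ 3) ℚ.* ι y ℚ.+ ι (+ 1)) (+ 1 / suc d) ⟩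
  ℚ.toℚᵘ (ι (+ 3) ℚ.* ι y ℚ.+ ι (+ 1)) ℚᵘ.* ℚ.toℚᵘ (+ 1 / suc d)
    ≈⟨ ℚᵘP.*-congʳ (ℚP.toℚᵘ-homo-+ (ι (+ 3) ℚ.* ι y) (ι (+ 1))) ⟩
  (ℚ.toℚᵘ (ι (+ 3) ℚ.* ι y) ℚᵘ.+ ℚ.toℚᵘ (ι (+ 1))) ℚᵘ.* ℚ.toℚᵘ (+ 1 / suc d)
    ≈⟨ ℚᵘP.*-congʳ (ℚᵘP.+-congˡ (ℚ.toℚᵘ (ι (+ 1))) (ℚP.toℚᵘ-homo-* (ι (+ 3)) (ι y))) ⟩
  (ℚ.toℚᵘ (ι (+ 3)) ℚᵘ.* ℚ.toℚᵘ (ι y) ℚᵘ.+ ℚ.toℚᵘ (ι (+ 1))) ℚᵘ.* ℚ.toℚᵘ (+ 1 / suc d)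
    ≈⟨ ℚᵘP.*-cong (ℚᵘP.+-cong (ℚᵘP.*-cong (toℚᵘ-/ (+ 3) 1) (toℚᵘ-/ y 1)) (toℚᵘ-/ (+ 1) 1))
                  (toℚᵘ-/ (+ 1) (suc d)) ⟩
  ((+ 3 ℚᵘ./ 1) ℚᵘ.* (y ℚᵘ./ 1) ℚᵘ.+ (+ 1 ℚᵘ./ 1)) ℚᵘ.* (+ 1 ℚᵘ./ suc d)
    ≈⟨ ℚᵘ.*≡* cross ⟩
  (+ 3 ℤ.* y ℤ.+ + 1) ℚᵘ./ suc d ∎
  where
  open ℚᵘP.≃-Reasoning
  normalise : ∀ u (D : ℤ) → (u ℤ.* + 1 ℤ.+ + 1 ℤ.* + 1) ℤ.* + 1 ℤ.* D ≡ (u ℤ.+ + 1) ℤ.* D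
  normalise = solve-∀
  cross : (+ 3 ℤ.* y ℤ.* + 1 ℤ.+ + 1 ℤ.* + 1) ℤ.* + 1 ℤ.* + suc d
        ≡ (+ 3 ℤ.* y ℤ.+ + 1) ℤ.* + suc (d ℕ.+ 0)
  cross = trans (normalise (+ 3 ℤ.* y) (+ suc d))
                (cong (λ e → (+ 3 ℤ.* y ℤ.+ + 1) ℤ.* + suc e) (sym (ℕP.+-identityʳ d)))

exact-quotient : ∀ N .{{_ : ℕ.NonZero N}} w z → + N ℤ.* z ≡ w → (w ℚᵘ./ N) ℚᵘ.≃ (z ℚᵘ./ 1)
exact-quotient (suc d) w z Nz≡w = ℚᵘ.*≡* (begin
  w ℤ.* + 1        ≡⟨ ℤP.*-identityʳ w ⟩
  w                ≡⟨ Nz≡w ⟨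
  + suc d ℤ.* z    ≡⟨ ℤP.*-comm (+ suc d) z ⟩
  z ℤ.* + suc d    ∎)
  where open ≡-Reasoning

step-integral : ∀ k (y z : ℤ) → + (2 ℕ.^ k) ℤ.* z ≡ + 3 ℤ.* y ℤ.+ + 1 → step (ι y) k ≡ ι z
step-integral k y z eq = ℚP.toℚᵘ-injective (begin
  ℚ.toℚᵘ (step (ι y) k)               ≈⟨ toℚᵘ-affine (2 ℕ.^ k) y ⟩
  (+ 3 ℤ.* y ℤ.+ + 1) ℚᵘ./ 2 ℕ.^ k   ≈⟨ exact-quotient (2 ℕ.^ k) _ z eq ⟩
  z ℚᵘ./ 1                            ≈⟨ ℚᵘP.≃-sym (toℚᵘ-/ z 1) ⟩
  ℚ.toℚᵘ (ι z)                        ∎)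
  where
  open ℚᵘP.≃-Reasoning
  instance _ = ℕP.m^n≢0 2 k

module _ (a : ℕ → ℕ) (x0 : ℤ) where

  Solves : ℕ → ℤ → Set
  Solves m y = + (2 ℕ.^ b a m) ℤ.* y ≡ + (3 ℕ.^ m) ℤ.* x0 ℤ.+ + (B a m)

  solves-suc : ∀ m y → Solves (suc m) y →
    + (2 ℕ.^ b a m) ℤ.* (+ (2 ℕ.^ a (suc m)) ℤ.* y ℤ.- + 1)
      ≡ + 3 ℤ.* (+ (3 ℕ.^ m) ℤ.* x0 ℤ.+ + (B a m))
  solves-suc m y h = begin
    P ℤ.* (Q ℤ.* y ℤ.- + 1)                        ≡⟨ distribute P Q y ⟩
    + (2 ℕ.^ b a m) ℤ.* + (2 ℕ.^ a (suc m)) ℤ.* y ℤ.- P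
      ≡⟨ cong (λ e → e ℤ.* y ℤ.- P) (ℤP.pos-* (2 ℕ.^ b a m) _) ⟨
    + (2 ℕ.^ b a m ℕ.* 2 ℕ.^ a (suc m)) ℤ.* y ℤ.- P
      ≡⟨ cong (λ e → + e ℤ.* y ℤ.- P) (ℕP.^-distribˡ-+-* 2 (b a m) (a (suc m))) ⟨
    + (2 ℕ.^ b a (suc m)) ℤ.* y ℤ.- P              ≡⟨ cong (ℤ._- P) h ⟩
    + (3 ℕ.* 3 ℕ.^ m) ℤ.* x0 ℤ.+ + B a (suc m) ℤ.- P
      ≡⟨ cong (λ e → + (3 ℕ.* 3 ℕ.^ m) ℤ.* x0 ℤ.+ + e ℤ.- P) (B-suc a m) ⟩
    + (3 ℕ.* 3 ℕ.^ m) ℤ.* x0 ℤ.+ + (3 ℕ.* B a m ℕ.+ 2 ℕ.^ b a m) ℤ.- P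
      ≡⟨ cong₂ (λ u v → u ℤ.* x0 ℤ.+ v ℤ.- P) (ℤP.pos-* 3 (3 ℕ.^ m))
               (trans (ℤP.pos-+ (3 ℕ.* B a m) _) (cong (ℤ._+ P) (ℤP.pos-* 3 (B a m)))) ⟩
    + 3 ℤ.* T ℤ.* x0 ℤ.+ (+ 3 ℤ.* Bm ℤ.+ P) ℤ.- P  ≡⟨ collect T Bm P x0 ⟩
    + 3 ℤ.* (T ℤ.* x0 ℤ.+ Bm)                      ∎
    where
    open ≡-Reasoning
    P Q T Bm : ℤ
    P  = + (2 ℕ.^ b a m)
    Q  = + (2 ℕ.^ a (suc m))
    T  = + (3 ℕ.^ m)
    Bm = + (B a m)
    distribute : ∀ P Q y → P ℤ.* (Q ℤ.* y ℤ.- + 1) ≡ P ℤ.* Q ℤ.* y ℤ.- P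
    distribute = solve-∀
    collect : ∀ T Bm P x → + 3 ℤ.* T ℤ.* x ℤ.+ (+ 3 ℤ.* Bm ℤ.+ P) ℤ.- P ≡ + 3 ℤ.* (T ℤ.* x ℤ.+ Bm)
    collect = solve-∀

  descend : ∀ m y → Solves (suc m) y →
    ∃[ y' ] Solves m y' × (+ (2 ℕ.^ a (suc m)) ℤ.* y ≡ + 3 ℤ.* y' ℤ.+ + 1)
  descend m y h = y' , sym R≡Py' , link
    where
    instance _ = ℕP.m^n≢0 2 (b a m)
    Qy R : ℤ
    Qy = + (2 ℕ.^ a (suc m)) ℤ.* y
    R  = + (3 ℕ.^ m) ℤ.* x0 ℤ.+ + (B a m)
    split : ∃[ y' ] (R ≡ + (2 ℕ.^ b a m) ℤ.* y') × (Qy ℤ.- + 1 ≡ + 3 ℤ.* y')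
    split = coprime-3-split (+ (2 ℕ.^ b a m)) (Qy ℤ.- + 1) R (2^-coprime-3 (b a m)) (solves-suc m y h)
    y' : ℤ
    y' = proj₁ split
    R≡Py' : R ≡ + (2 ℕ.^ b a m) ℤ.* y'
    R≡Py' = proj₁ (proj₂ split)
    Qy-1≡3y' : Qy ℤ.- + 1 ≡ + 3 ℤ.* y'
    Qy-1≡3y' = proj₂ (proj₂ split)
    add-back : ∀ u → u ≡ u ℤ.- + 1 ℤ.+ + 1
    add-back = solve-∀
    link : Qy ≡ + 3 ℤ.* y' ℤ.+ + 1
    link = trans (add-back Qy) (cong (ℤ._+ + 1) Qy-1≡3y')

  descend-by : ∀ k m y → Solves (k ℕ.+ m) y → ∃[ z ] Solves m z
  descend-by zero    m y h = y , h
  descend-by (suc k) m y h = let (y' , h' , _) = descend (k ℕ.+ m) y h in descend-by k m y' h'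

  solves-zero : ∀ y → Solves 0 y → y ≡ x0
  solves-zero y h = begin
    y                       ≡⟨ ℤP.*-identityˡ y ⟨
    + 1 ℤ.* y               ≡⟨ h ⟩
    + 1 ℤ.* x0 ℤ.+ + 0      ≡⟨ ℤP.+-identityʳ _ ⟩
    + 1 ℤ.* x0              ≡⟨ ℤP.*-identityˡ x0 ⟩
    x0                      ∎
    where open ≡-Reasoning

  solves⇒iterate : ∀ m y → Solves m y → xs a x0 m ≡ ι y
  solves⇒iterate zero    y h = cong ι (sym (solves-zero y h))
  solves⇒iterate (suc m) y h = let (y' , h' , link) = descend m y h in begin
    step (xs a x0 m) (a (suc m))  ≡⟨ cong (λ q → step q (a (suc m))) (solves⇒iterate m y' h') ⟩
    step (ι y') (a (suc m))       ≡⟨ step-integral (a (suc m)) y' y link ⟩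
    ι y                           ∎
    where open ≡-Reasoning

sub⇒add : ∀ {A C D : ℤ} → A ℤ.- C ≡ D → A ≡ C ℤ.+ D
sub⇒add {A} {C} {D} A-C≡D = begin
  A                  ≡⟨ regroup A C ⟩
  C ℤ.+ (A ℤ.- C)    ≡⟨ cong (λ e → C ℤ.+ e) A-C≡D ⟩
  C ℤ.+ D            ∎
  where
  open ≡-Reasoning
  regroup : ∀ A C → A ≡ C ℤ.+ (A ℤ.- C)
  regroup = solve-∀

proposition2p4 : (a : ℕ → ℕ) → (∀ i → 1 ≤ i → 0 < a i) →
    (n : ℕ) → 1 ≤ n → (xn x0 : ℤ) →
    (ℤ.+ (2 ℕ.^ b a n)) ℤ.* xn ℤ.- (ℤ.+ (3 ℕ.^ n)) ℤ.* x0 ≡ ℤ.+ (B a n) →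
    (ι xn ≡ step (xs a x0 (n ℕ.∸ 1)) (a n))
    × (∀ i → i < n → ∃[ z ] xs a x0 i ≡ ι z)
proposition2p4 a _ n@(suc _) _ xn x0 h = sym (solves⇒iterate a x0 n xn hn) , earlier
  where
  hn : Solves a x0 n xn
  hn = sub⇒add h
  earlier : ∀ i → i < n → ∃[ z ] xs a x0 i ≡ ι z
  earlier i i<n =
    let (z , hz) = descend-by a x0 (n ∸ i) i xn
                     (subst (λ k → Solves a x0 k xn) (sym (ℕP.m∸n+n≡m (ℕP.<⇒≤ i<n))) hn)
    in z , solves⇒iterate a x0 i z hz
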